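{- Let $\mathcal{R}$ be a rewrite system on terms. The Cut rule is redundant in asymmetric atomic deduction modulo $\mathcal{R}$ (i.e. every sequent provable in this system has a proof not using the Cut rule) if and only if $\mathcal{R}$ is confluent.
   Context: Fix a first-order language. A rewrite rule is a pair of terms $\langle l, r\rangle$, written $l \rightarrow r$, where $l$ is not a variable; a rewrite system is a set of rewrite rules. The relation $\rightarrow^{1}$ is the smallest relation on terms and on propositions that is compatible with the structure of terms and propositions and such that $\theta l \rightarrow^{1} \theta r$ for every substitution $\theta$ and every rule $l \rightarrow r$. $\rightarrow^{*}$ is its reflexive-transitive closure and $\leftarrow^{*}$ the converse of $\rightarrow^{*}$. $\mathcal{R}$ is confluent if whenever $u \leftarrow^{*} t \rightarrow^{*} v$ there is $w$ with $u \rightarrow^{*} w \leftarrow^{*} v$. Sequents $\Gamma \vdash \Delta$ have finite multisets $\Gamma,\Delta$ of propositions. Asymmetric atomic deduction modulo $\mathcal{R}$ is the proof system in which all propositions are atomic and whose only rules are: Axiom: $\Gamma, A_1 \vdash A_2, \Delta$ with no premise, provided there is $A$ with $A_1 \rightarrow^{*} A \leftarrow^{*} A_2$; Cut: from $\Gamma \vdash C_1, \Delta$ and $\Gamma, C_2 \vdash \Delta$ infer $\Gamma \vdash \Delta$, provided there is $C$ with $C_1 \leftarrow^{*} C \rightarrow^{*} C_2$; contraction-left: from $\Gamma, A_1, A_2 \vdash \Delta$ infer $\Gamma, A \vdash \Delta$ provided $A_1 \leftarrow^{*} A \rightarrow^{*} A_2$; contraction-right: from $\Gamma \vdash A_1,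 A_2, \Delta$ infer $\Gamma \vdash A, \Delta$ provided $A_1 \leftarrow^{*} A \rightarrow^{*} A_2$; weakening-left: from $\Gamma \vdash \Delta$ infer $\Gamma, A \vdash \Delta$; weakening-right: from $\Gamma \vdash \Delta$ infer $\Gamma \vdash A, \Delta$. -}

module Defs where

open import Data.Nat using (ℕ; suc)
open import Data.Fin using (Fin; zero; suc)
open import Data.Vec using (Vec; []; _∷_)
open import Data.Bool using (Bool; true; false)
open import Data.List using (List; _∷_)
open import Data.Product using (Σ; ∃; _×_; _,_)
open import Relation.Nullary using (¬_)
open import Relation.Binary.PropositionalEquality using (_≡_)
open import Relation.Binary.Construct.Closure.ReflexiveTransitive using (Star)
open import Data.List.Relation.Binary.Permutation.Propositional using (_↭_)

record Signature : Set₁ where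
  field
    FunSym  : Set
    funAr   : FunSym → ℕ
    PredSym : Set
    predAr  : PredSym → ℕ

module _ (σ : Signature) where
  open Signature σ

  data Term : Set where
    var : ℕ → Term
    fun : (f : FunSym) → Vec Term (funAr f) → Term

  data Atom : Set where
    pred : (p : PredSym) → Vec Term (predAr p) → Atom

  IsVar : Term → Set
  IsVar t = Σ ℕ λ x → t ≡ var x

  Subst : Set
  Subst = ℕ → Term

  mutual
    sub : Subst → Term → Term
    sub θ (var x)    = θ x
    sub θ (fun f ts) = fun f (subs θ ts)

    subs : ∀ {n} → Subst → Vec Term n → Vec Term n
    subs θ []       = []
    subs θ (t ∷ ts) = sub θ t ∷ subs θ ts

  record RewriteSystem : Set₁ where
    field
      Rule      : Term → Term → Set
      lhsNotVar : ∀ {l r} → Rule l r → ¬ IsVar l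

  module _ (R : RewriteSystem) where
    open RewriteSystem R

    mutual
      data _⟶₁_ : Term → Term → Set where
        root : ∀ {l r} (θ : Subst) → Rule l r → sub θ l ⟶₁ sub θ r
        arg  : ∀ {f ts us} → ts ⟶₁ᵛ us → fun f ts ⟶₁ fun f us

      data _⟶₁ᵛ_ : ∀ {n} → Vec Term n → Vec Term n → Set where
        here  : ∀ {n t u} {ts : Vec Term n} → t ⟶₁ u → (t ∷ ts) ⟶₁ᵛ (u ∷ ts)
        there : ∀ {n t} {ts us : Vec Term n} → ts ⟶₁ᵛ us → (t ∷ ts) ⟶₁ᵛ (t ∷ us)

    data _⟶₁ᴬ_ : Atom → Atom → Set where
      predArg : ∀ {p ts us} → ts ⟶₁ᵛ us → pred p ts ⟶₁ᴬ pred p us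

    _⟶*_ : Term → Term → Set
    _⟶*_ = Star _⟶₁_

    _⟶*ᴬ_ : Atom → Atom → Set
    _⟶*ᴬ_ = Star _⟶₁ᴬ_

    ConfluentTerms : Set
    ConfluentTerms = ∀ {t u v} → t ⟶* u → t ⟶* v → ∃ λ w → (u ⟶* w) × (v ⟶* w)

    ConfluentAtoms : Set
    ConfluentAtoms = ∀ {t u v} → t ⟶*ᴬ u → t ⟶*ᴬ v → ∃ λ w → (u ⟶*ᴬ w) × (v ⟶*ᴬ w)

    Confluent : Set
    Confluent = ConfluentTerms × ConfluentAtoms

    Joinable : Atom → Atom → Set
    Joinable A₁ A₂ = ∃ λ A → (A₁ ⟶*ᴬ A) × (A₂ ⟶*ᴬ A)

    CommonAncestor : Atom → Atom → Set
    CommonAncestor A₁ A₂ = ∃ λ A → (A ⟶*ᴬ A₁) × (A ⟶*ᴬ A₂)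

    -- Sequents Γ ⊢ Δ use lists, and
    -- the rule `perm` identifies sequents whose sides are permutations of
    -- each other, so that Γ, Δ behave as finite multisets.  The Bool index
    -- records whether Cut may be used (true) or not (false).
    data _⊢[_]_ : List Atom → Bool → List Atom → Set where
      perm  : ∀ {b Γ Γ' Δ Δ'} → Γ ↭ Γ' → Δ ↭ Δ' → Γ ⊢[ b ] Δ → Γ' ⊢[ b ] Δ'
      axiom : ∀ {b Γ Δ A₁ A₂} → Joinable A₁ A₂ → (A₁ ∷ Γ) ⊢[ b ] (A₂ ∷ Δ)
      cut   : ∀ {Γ Δ C₁ C₂} → CommonAncestor C₁ C₂ →
              Γ ⊢[ true ] (C₁ ∷ Δ) → (C₂ ∷ Γ) ⊢[ true ] Δ → Γ ⊢[ true ] Δ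
      contrL : ∀ {b Γ Δ A A₁ A₂} → A ⟶*ᴬ A₁ → A ⟶*ᴬ A₂ →
               (A₁ ∷ A₂ ∷ Γ) ⊢[ b ] Δ → (A ∷ Γ) ⊢[ b ] Δ
      contrR : ∀ {b Γ Δ A A₁ A₂} → A ⟶*ᴬ A₁ → A ⟶*ᴬ A₂ →
               Γ ⊢[ b ] (A₁ ∷ A₂ ∷ Δ) → Γ ⊢[ b ] (A ∷ Δ)
      weakL : ∀ {b Γ Δ A} → Γ ⊢[ b ] Δ → (A ∷ Γ) ⊢[ b ] Δ
      weakR : ∀ {b Γ Δ A} → Γ ⊢[ b ] Δ → Γ ⊢[ b ] (A ∷ Δ)

    CutRedundant : Set
    CutRedundant = ∀ {Γ Δ} → Γ ⊢[ true ] Δ → Γ ⊢[ false ] Δ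

-- Cut-free derivability has a simple semantics: Γ ⊢ Δ is derivable iff some
-- A ∈ Γ and B ∈ Δ are joinable.  Every rule except Cut preserves this
-- invariant outright; Cut preserves it when →* is confluent, since then the
-- common ancestor of C₁ and C₂ makes them joinable.  Conversely, cutting the
-- axioms A₁ ⊢ A₁ and A₂ ⊢ A₂ on a common ancestor of A₁ and A₂ proves A₁ ⊢ A₂,
-- and a cut-free proof of it forces A₁ and A₂ to be joinable.  Confluence on
-- terms is inherited from confluence on propositions by using terms as the
-- first argument of a predicate symbol of positive arity.
module Submission where

open import Defs hiding (Term; Atom; _⟶₁ᵛ_; _⟶*_; _⟶*ᴬ_; ConfluentTerms; ConfluentAtoms; Joinable; CommonAncestor; _⊢[_]_)
open import Data.Nat using (suc; _≥_; _≤_; s≤s; z≤n)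
open import Data.Product using (Σ; ∃; _×_; _,_)
open import Data.Bool using (true; false)
open import Data.List using (List; []; _∷_)
open import Data.Vec using (Vec; _∷_; head; replicate)
open import Data.List.Membership.Propositional using (_∈_)
open import Data.List.Relation.Unary.Any using (here; there)
open import Data.List.Relation.Binary.Permutation.Propositional using (_↭_)
open import Data.List.Relation.Binary.Permutation.Propositional.Properties using (∈-resp-↭)
open import Relation.Binary.PropositionalEquality using (_≡_; refl)
open import Relation.Binary.Construct.Closure.ReflexiveTransitive using (Star; ε; _◅_; _◅◅_; gmap)

module Modulo {σ : Signature} (R : RewriteSystem σ) where
  open Signature σ

  Term = Defs.Term σ
  Atom = Defs.Atom σ
  _⟶₁ᵛ_ : ∀ {n} → Vec Term n → Vec Term n → Set
  _⟶₁ᵛ_ = Defs._⟶₁ᵛ_ σ R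
  _⟶*_ = Defs._⟶*_ σ R
  _⟶*ᴬ_ = Defs._⟶*ᴬ_ σ R
  ConfluentTerms = Defs.ConfluentTerms σ R
  ConfluentAtoms = Defs.ConfluentAtoms σ R
  Joinable = Defs.Joinable σ R
  CommonAncestor = Defs.CommonAncestor σ R
  _⊢[_]_ = Defs._⊢[_]_ σ R

  joinable-expandˡ : ∀ {A A₁ B} → A ⟶*ᴬ A₁ → Joinable A₁ B → Joinable A B
  joinable-expandˡ r (C , a , b) = C , r ◅◅ a , b

  joinable-expandʳ : ∀ {A B B₁} → B ⟶*ᴬ B₁ → Joinable A B₁ → Joinable A B
  joinable-expandʳ r (C , a , b) = C , a , r ◅◅ b

  joinable-throughAncestor : ConfluentAtoms → ∀ {A C₁ C₂ B} →
    Joinable A C₁ → CommonAncestor C₁ C₂ → Joinable C₂ B → Joinable A B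
  joinable-throughAncestor confluent (X , a⟶X , c₁⟶X) (C , c⟶c₁ , c⟶c₂) (Y , c₂⟶Y , b⟶Y)
    with confluent (c⟶c₁ ◅◅ c₁⟶X) (c⟶c₂ ◅◅ c₂⟶Y)
  ... | Z , X⟶Z , Y⟶Z = Z , a⟶X ◅◅ X⟶Z , b⟶Y ◅◅ Y⟶Z

  ∈-contract : ∀ {A A₁ A₂ X Γ} → A ⟶*ᴬ A₁ → A ⟶*ᴬ A₂ →
    X ∈ A₁ ∷ A₂ ∷ Γ → ∃ λ Y → Y ∈ A ∷ Γ × Y ⟶*ᴬ X
  ∈-contract r₁ r₂ (here refl)         = _ , here refl , r₁
  ∈-contract r₁ r₂ (there (here refl)) = _ , here refl , r₂
  ∈-contract r₁ r₂ (there (there x∈Γ)) = _ , there x∈Γ , ε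

  HasJoinablePair : List Atom → List Atom → Set
  HasJoinablePair Γ Δ = ∃ λ A → ∃ λ B → A ∈ Γ × B ∈ Δ × Joinable A B

  hasJoinablePair-resp-↭ : ∀ {Γ Γ' Δ Δ'} → Γ ↭ Γ' → Δ ↭ Δ' →
    HasJoinablePair Γ Δ → HasJoinablePair Γ' Δ'
  hasJoinablePair-resp-↭ p q (A , B , a , b , j) = A , B , ∈-resp-↭ p a , ∈-resp-↭ q b , j

  hasJoinablePair-contractˡ : ∀ {A A₁ A₂ Γ Δ} → A ⟶*ᴬ A₁ → A ⟶*ᴬ A₂ →
    HasJoinablePair (A₁ ∷ A₂ ∷ Γ) Δ → HasJoinablePair (A ∷ Γ) Δ
  hasJoinablePair-contractˡ r₁ r₂ (X , B , x , b , j) with ∈-contract r₁ r₂ x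
  ... | Y , y , Y⟶X = Y , B , y , b , joinable-expandˡ Y⟶X j

  hasJoinablePair-contractʳ : ∀ {A A₁ A₂ Γ Δ} → A ⟶*ᴬ A₁ → A ⟶*ᴬ A₂ →
    HasJoinablePair Γ (A₁ ∷ A₂ ∷ Δ) → HasJoinablePair Γ (A ∷ Δ)
  hasJoinablePair-contractʳ r₁ r₂ (B , X , b , x , j) with ∈-contract r₁ r₂ x
  ... | Y , y , Y⟶X = B , Y , b , y , joinable-expandʳ Y⟶X j

  hasJoinablePair-cut : ConfluentAtoms → ∀ {Γ Δ C₁ C₂} → CommonAncestor C₁ C₂ →
    HasJoinablePair Γ (C₁ ∷ Δ) → HasJoinablePair (C₂ ∷ Γ) Δ → HasJoinablePair Γ Δ
  hasJoinablePair-cut _ _ (A , B , a , there b , j) _ = A , B , a , b , j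
  hasJoinablePair-cut _ _ _ (A , B , there a , b , j) = A , B , a , b , j
  hasJoinablePair-cut confluent c (A , _ , a , here refl , j) (_ , B , here refl , b , k) =
    A , B , a , b , joinable-throughAncestor confluent j c k

  ⊢⇒hasJoinablePair : ∀ {b Γ Δ} → (b ≡ true → ConfluentAtoms) → Γ ⊢[ b ] Δ → HasJoinablePair Γ Δ
  ⊢⇒hasJoinablePair c (perm p q d)      = hasJoinablePair-resp-↭ p q (⊢⇒hasJoinablePair c d)
  ⊢⇒hasJoinablePair c (axiom j)         = _ , _ , here refl , here refl , j
  ⊢⇒hasJoinablePair c (cut a d e)       =
    hasJoinablePair-cut (c refl) a (⊢⇒hasJoinablePair c d) (⊢⇒hasJoinablePair c e)
  ⊢⇒hasJoinablePair c (contrL r₁ r₂ d) = hasJoinablePair-contractˡ r₁ r₂ (⊢⇒hasJoinablePair c d)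
  ⊢⇒hasJoinablePair c (contrR r₁ r₂ d) = hasJoinablePair-contractʳ r₁ r₂ (⊢⇒hasJoinablePair c d)
  ⊢⇒hasJoinablePair c (weakL d) with ⊢⇒hasJoinablePair c d
  ... | A , B , a , b , j = A , B , there a , b , j
  ⊢⇒hasJoinablePair c (weakR d) with ⊢⇒hasJoinablePair c d
  ... | A , B , a , b , j = A , B , a , there b , j

  weakened-axiom : ∀ {A B Γ Δ} → A ∈ Γ → B ∈ Δ → Joinable A B → Γ ⊢[ false ] Δ
  weakened-axiom (here refl) (here refl) j = axiom j
  weakened-axiom (here refl) (there b)   j = weakR (weakened-axiom (here refl) b j)
  weakened-axiom (there a)   b           j = weakL (weakened-axiom a b j)

  hasJoinablePair⇒cutFree : ∀ {Γ Δ} → HasJoinablePair Γ Δ → Γ ⊢[ false ] Δ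
  hasJoinablePair⇒cutFree (_ , _ , a , b , j) = weakened-axiom a b j

  confluentAtoms⇒cutRedundant : ConfluentAtoms → CutRedundant σ R
  confluentAtoms⇒cutRedundant confluent d =
    hasJoinablePair⇒cutFree (⊢⇒hasJoinablePair (λ _ → confluent) d)

  cutRedundant⇒confluentAtoms : CutRedundant σ R → ConfluentAtoms
  cutRedundant⇒confluentAtoms cutFree {C} {A₁} {A₂} r₁ r₂
    with ⊢⇒hasJoinablePair (λ ()) (cutFree peak)
    where
    peak : (A₁ ∷ []) ⊢[ true ] (A₂ ∷ [])
    peak = cut (C , r₁ , r₂) (axiom (A₁ , ε , ε)) (axiom (A₂ , ε , ε))
  ... | _ , _ , here refl , here refl , j = j

  head-⟶* : ∀ {n} {ts us : Vec Term (suc n)} → Star _⟶₁ᵛ_ ts us → head ts ⟶* head us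
  head-⟶* ε                 = ε
  head-⟶* (here t⟶u ◅ rs) = t⟶u ◅ head-⟶* rs
  head-⟶* (there _ ◅ rs)   = head-⟶* rs

  pred-⟶*ᴬ : ∀ {p ts us} → Star _⟶₁ᵛ_ ts us → pred p ts ⟶*ᴬ pred p us
  pred-⟶*ᴬ = gmap _ predArg

  pred-⟶*ᴬ-inv : ∀ {p ts B} → pred p ts ⟶*ᴬ B → ∃ λ us → B ≡ pred p us × Star _⟶₁ᵛ_ ts us
  pred-⟶*ᴬ-inv ε = _ , refl , ε
  pred-⟶*ᴬ-inv (predArg r ◅ rs) with pred-⟶*ᴬ-inv rs
  ... | us , refl , rs' = us , refl , r ◅ rs'

  padded : ∀ {n} → 1 ≤ n → Term → Vec Term n
  padded (s≤s z≤n) t = t ∷ replicate _ (var 0)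

  firstArg : ∀ {n} → 1 ≤ n → Vec Term n → Term
  firstArg (s≤s _) = head

  firstArg-padded : ∀ {n} (1≤n : 1 ≤ n) t → firstArg 1≤n (padded 1≤n t) ≡ t
  firstArg-padded (s≤s z≤n) t = refl

  padded-⟶* : ∀ {n} (1≤n : 1 ≤ n) {t u} → t ⟶* u → Star _⟶₁ᵛ_ (padded 1≤n t) (padded 1≤n u)
  padded-⟶* (s≤s z≤n) = gmap _ here

  firstArg-⟶* : ∀ {n} (1≤n : 1 ≤ n) {ts us} → Star _⟶₁ᵛ_ ts us → firstArg 1≤n ts ⟶* firstArg 1≤n us
  firstArg-⟶* (s≤s _) = head-⟶*

  confluentAtoms⇒confluentTerms : Σ PredSym (λ p → predAr p ≥ 1) → ConfluentAtoms → ConfluentTerms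
  confluentAtoms⇒confluentTerms (p , 1≤ar) confluent {t} {u} {v} t⟶u t⟶v
    with confluent (pred-⟶*ᴬ {p} (padded-⟶* 1≤ar t⟶u)) (pred-⟶*ᴬ {p} (padded-⟶* 1≤ar t⟶v))
  ... | _ , u⟶W , v⟶W with pred-⟶*ᴬ-inv u⟶W | pred-⟶*ᴬ-inv v⟶W
  ... | ws , refl , us⟶ws | _ , refl , vs⟶ws =
    firstArg 1≤ar ws , fromPadded u us⟶ws , fromPadded v vs⟶ws
    where
    fromPadded : ∀ s → Star _⟶₁ᵛ_ (padded 1≤ar s) ws → s ⟶* firstArg 1≤ar ws
    fromPadded s r with firstArg-⟶* 1≤ar r
    ... | s⟶w rewrite firstArg-padded 1≤ar s = s⟶w

proposition5 : (σ : Signature) →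
    Σ (Signature.PredSym σ) (λ p → Signature.predAr σ p ≥ 1) →
    (R : RewriteSystem σ) →
    (CutRedundant σ R → Confluent σ R) × (Confluent σ R → CutRedundant σ R)
proposition5 σ positiveArity R = cutRedundant⇒confluent , confluent⇒cutRedundant
  where
  open Modulo R

  cutRedundant⇒confluent : CutRedundant σ R → Confluent σ R
  cutRedundant⇒confluent cutFree =
    confluentAtoms⇒confluentTerms positiveArity atoms , atoms
    where atoms = cutRedundant⇒confluentAtoms cutFree

  confluent⇒cutRedundant : Confluent σ R → CutRedundant σ R
  confluent⇒cutRedundant (_ , atoms) = confluentAtoms⇒cutRedundant atoms
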